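{- Let $d\ge 1$ and $r\ge 1$ be integers and let $\tilde G$ be the edge-weighted graph with vertex set $\{x\in\mathbb{Z}^d:\|x\|_\infty\le r\}$ and edge set $E_0\cup E_{\mathrm{sp}}$, where $E_0=\{(u,v):\|u-v\|_1=1\}$ (each of weight $1$) and $E_{\mathrm{sp}}=\{(u,v):u=-v,\ \|u\|_\infty=r\}$ (special edges, each of weight $0$). Let $u,v$ be vertices of $\tilde G$ and let $P$ be a walk from $u$ to $v$ in $\tilde G$. If the number of special edges traversed by $P$ is even, then $\ell(P)\ge \|u-v\|_1$, where $\ell(P)$ is the total weight of the edges traversed by $P$.
   Context: A walk from $u$ to $v$ is a sequence of vertices starting at $u$ and ending at $v$ in which consecutive vertices are joined by an edge of $\tilde G$; edges are counted with multiplicity both in the length and in the count of special edges. -}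

module Defs where

open import Data.Nat using (ℕ; zero; suc; _+_; _≤_)
open import Data.Nat.Properties using ()
open import Data.Integer as ℤ using (ℤ; ∣_∣; _-_; -_)
open import Data.Fin using (Fin; zero; suc)
open import Data.Product using (Σ; ∃; _×_; _,_)
import Data.Product
open import Relation.Binary.PropositionalEquality using (_≡_)

Point : ℕ → Set
Point d = Fin d → ℤ

sumFin : ∀ {d} → (Fin d → ℕ) → ℕ
sumFin {zero}  f = 0
sumFin {suc d} f = f zero + sumFin (λ i → f (suc i))

dist₁ : ∀ {d} → Point d → Point d → ℕ
dist₁ u v = sumFin (λ i → ∣ u i - v i ∣)

InBox : ∀ {d} → ℕ → Point d → Set
InBox r x = ∀ i → ∣ x i ∣ ≤ r

OnBoundary : ∀ {d} → ℕ → Point d → Set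
OnBoundary r x = InBox r x × ∃ λ i → ∣ x i ∣ ≡ r

Vertex : ℕ → ℕ → Set
Vertex d r = Σ (Point d) (InBox r)

-- Edges of G̃ between two vertices (an edge is traversed in either direction;
-- both E₀ and E_sp are symmetric relations).
data Edge {d r : ℕ} (u v : Vertex d r) : Set where
  ordinary : dist₁ (Data.Product.proj₁ u) (Data.Product.proj₁ v) ≡ 1 → Edge u v
  special  : (∀ i → Data.Product.proj₁ u i ≡ - Data.Product.proj₁ v i) →
             OnBoundary r (Data.Product.proj₁ u) → Edge u v

edgeWeight : ∀ {d r} {u v : Vertex d r} → Edge u v → ℕ
edgeWeight (ordinary _)  = 1
edgeWeight (special _ _) = 0

edgeSpecial : ∀ {d r} {u v : Vertex d r} → Edge u v → ℕ
edgeSpecial (ordinary _)  = 0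
edgeSpecial (special _ _) = 1

data Walk {d r : ℕ} : Vertex d r → Vertex d r → Set where
  [] : ∀ {u} → Walk u u
  _∷_ : ∀ {u w v} → Edge u w → Walk w v → Walk u v

weight : ∀ {d r} {u v : Vertex d r} → Walk u v → ℕ
weight []       = 0
weight (e ∷ p)  = edgeWeight e + weight p

specialCount : ∀ {d r} {u v : Vertex d r} → Walk u v → ℕ
specialCount []      = 0
specialCount (e ∷ p) = edgeSpecial e + specialCount p

-- Each ordinary edge moves the walker by ℓ₁-distance 1 and each special edge
-- replaces the current vertex x by −x.  Hence after a walk from u to v with
-- k special edges, the triangle inequality gives ‖u − (−1)ᵏ v‖₁ ≤ ℓ(P); for k
-- even this is the claim.
module Submission where

open import Defs
open import Data.Nat using (ℕ; zero; suc; _+_; _*_; _≤_; _≥_; z≤n)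
open import Data.Nat.Properties
  using (+-mono-≤; +-monoʳ-≤; ≤-reflexive; ≤-trans; +-commutativeSemigroup; module ≤-Reasoning)
open import Data.Nat.Divisibility using (_∣_; divides)
open import Data.Integer using (ℤ; ∣_∣; _-_; -_)
open import Data.Integer.Properties
  using (∣-i∣≡∣i∣; ∣i+j∣≤∣i∣+∣j∣; neg-distrib-+; neg-involutive; +-inverseʳ; +-minus-telescope)
open import Data.Fin using (Fin; zero; suc)
open import Data.Product using (proj₁; _,_)
open import Relation.Binary.PropositionalEquality using (_≡_; refl; sym; trans; cong; cong₂; subst)
open import Algebra.Properties.CommutativeSemigroup +-commutativeSemigroup using (interchange)

sumFin-cong : ∀ {d} {f g : Fin d → ℕ} → (∀ i → f i ≡ g i) → sumFin f ≡ sumFin g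
sumFin-cong {zero}  f≡g = refl
sumFin-cong {suc d} f≡g = cong₂ _+_ (f≡g zero) (sumFin-cong (λ i → f≡g (suc i)))

sumFin-mono-≤ : ∀ {d} {f g : Fin d → ℕ} → (∀ i → f i ≤ g i) → sumFin f ≤ sumFin g
sumFin-mono-≤ {zero}  f≤g = z≤n
sumFin-mono-≤ {suc d} f≤g = +-mono-≤ (f≤g zero) (sumFin-mono-≤ (λ i → f≤g (suc i)))

sumFin-distrib-+ : ∀ {d} (f g : Fin d → ℕ) →
  sumFin (λ i → f i + g i) ≡ sumFin f + sumFin g
sumFin-distrib-+ {zero}  f g = refl
sumFin-distrib-+ {suc d} f g =
  trans (cong (f zero + g zero +_) (sumFin-distrib-+ (λ i → f (suc i)) (λ i → g (suc i))))
        (interchange (f zero) (g zero) _ _)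

∣i-k∣≤∣i-j∣+∣j-k∣ : ∀ i j k → ∣ i - k ∣ ≤ ∣ i - j ∣ + ∣ j - k ∣
∣i-k∣≤∣i-j∣+∣j-k∣ i j k =
  subst (λ t → ∣ t ∣ ≤ ∣ i - j ∣ + ∣ j - k ∣) (+-minus-telescope i j k)
        (∣i+j∣≤∣i∣+∣j∣ (i - j) (j - k))

∣-i--j∣≡∣i-j∣ : ∀ i j → ∣ - i - - j ∣ ≡ ∣ i - j ∣
∣-i--j∣≡∣i-j∣ i j = trans (cong ∣_∣ (sym (neg-distrib-+ i (- j)))) (∣-i∣≡∣i∣ (i - j))

dist₁-self : ∀ {d} (x : Point d) → dist₁ x x ≡ 0
dist₁-self {zero}  x = refl
dist₁-self {suc d} x rewrite +-inverseʳ (x zero) = dist₁-self (λ i → x (suc i))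

dist₁-triangle : ∀ {d} (x y z : Point d) → dist₁ x z ≤ dist₁ x y + dist₁ y z
dist₁-triangle x y z = ≤-trans
  (sumFin-mono-≤ (λ i → ∣i-k∣≤∣i-j∣+∣j-k∣ (x i) (y i) (z i)))
  (≤-reflexive (sumFin-distrib-+ (λ i → ∣ x i - y i ∣) (λ i → ∣ y i - z i ∣)))

dist₁-cong : ∀ {d} {x x′ y y′ : Point d} →
  (∀ i → x i ≡ x′ i) → (∀ i → y i ≡ y′ i) → dist₁ x y ≡ dist₁ x′ y′
dist₁-cong x≡x′ y≡y′ = sumFin-cong (λ i → cong₂ (λ a b → ∣ a - b ∣) (x≡x′ i) (y≡y′ i))

dist₁-neg : ∀ {d} (x y : Point d) → dist₁ (λ i → - x i) (λ i → - y i) ≡ dist₁ x y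
dist₁-neg x y = sumFin-cong (λ i → ∣-i--j∣≡∣i-j∣ (x i) (y i))

negateⁿ : ℕ → ℤ → ℤ
negateⁿ zero    z = z
negateⁿ (suc n) z = - negateⁿ n z

negateⁿ-even : ∀ q z → negateⁿ (q * 2) z ≡ z
negateⁿ-even zero    z = refl
negateⁿ-even (suc q) z = trans (neg-involutive _) (negateⁿ-even q z)

reflectⁿ : ∀ {d} → ℕ → Point d → Point d
reflectⁿ n x i = negateⁿ n (x i)

walk-dist₁-reflectⁿ-≤-weight : ∀ {d r} {u v : Vertex d r} (P : Walk u v) →
  dist₁ (proj₁ u) (reflectⁿ (specialCount P) (proj₁ v)) ≤ weight P
walk-dist₁-reflectⁿ-≤-weight {u = u} [] = ≤-reflexive (dist₁-self (proj₁ u))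
walk-dist₁-reflectⁿ-≤-weight {u = u} {v} (_∷_ {w = w} (ordinary u~w) P) = begin
  dist₁ (proj₁ u) v′                             ≤⟨ dist₁-triangle (proj₁ u) (proj₁ w) v′ ⟩
  dist₁ (proj₁ u) (proj₁ w) + dist₁ (proj₁ w) v′ ≡⟨ cong (_+ dist₁ (proj₁ w) v′) u~w ⟩
  1 + dist₁ (proj₁ w) v′                         ≤⟨ +-monoʳ-≤ 1 (walk-dist₁-reflectⁿ-≤-weight P) ⟩
  1 + weight P                                   ∎
  where
  open ≤-Reasoning
  v′ = reflectⁿ (specialCount P) (proj₁ v)
walk-dist₁-reflectⁿ-≤-weight {u = u} {v} (_∷_ {w = w} (special u≡-w _) P) = begin
  dist₁ (proj₁ u) (λ i → - v′ i)           ≡⟨ dist₁-cong u≡-w (λ _ → refl) ⟩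
  dist₁ (λ i → - proj₁ w i) (λ i → - v′ i) ≡⟨ dist₁-neg (proj₁ w) v′ ⟩
  dist₁ (proj₁ w) v′                       ≤⟨ walk-dist₁-reflectⁿ-≤-weight P ⟩
  weight P                                 ∎
  where
  open ≤-Reasoning
  v′ = reflectⁿ (specialCount P) (proj₁ v)

claim2 : (d r : ℕ) → d ≥ 1 → r ≥ 1 → (u v : Vertex d r) → (P : Walk u v) →
    2 ∣ specialCount P → dist₁ (proj₁ u) (proj₁ v) ≤ weight P
claim2 d r _ _ (u , _) (v , _) P (divides q count≡q*2) = begin
  dist₁ u v                             ≡⟨ dist₁-cong {x = u} (λ _ → refl) (λ i → sym (negateⁿ-even q (v i))) ⟩
  dist₁ u (reflectⁿ (q * 2) v)          ≡⟨ cong (λ n → dist₁ u (reflectⁿ n v)) (sym count≡q*2) ⟩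
  dist₁ u (reflectⁿ (specialCount P) v) ≤⟨ walk-dist₁-reflectⁿ-≤-weight P ⟩
  weight P                              ∎
  where open ≤-Reasoning
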